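{- For every integer $n\geq 3$, $O\chi(C_n)=\lceil\sqrt{n}\,\rceil$ if and only if $n>4$.
   Context: $C_n$ denotes the cycle graph on $n$ vertices. All colourings are proper vertex colourings. Two colourings $c_1,c_2$ of a graph are orthogonal if whenever two distinct vertices receive the same colour in one colouring, they receive distinct colours in the other (equivalently, no colour pair $(c_1(v),c_2(v))$ occurs at two distinct vertices). An orthogonal colouring is a pair of orthogonal proper colourings; $O\chi(G)$, the orthogonal chromatic number, is the minimum number of colours needed for an orthogonal colouring of $G$ (both colourings drawing from the same set of that many colours). -}

module Defs where

open import Data.Nat using (ℕ; suc; _+_; _*_; _≤_; _<_)
open import Data.Fin using (Fin; toℕ)
open import Data.Sum using (_⊎_)
open import Data.Product using (Σ; _×_; _,_)
open import Function.Definitions using (Injective)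
open import Relation.Binary.PropositionalEquality using (_≡_)
open import Relation.Nullary using (¬_)

CycleSucc : (n : ℕ) → Fin n → Fin n → Set
CycleSucc n i j = (toℕ j ≡ suc (toℕ i)) ⊎ ((suc (toℕ i) ≡ n) × (toℕ j ≡ 0))

-- Cycle graph C_n on vertex set Fin n: i ~ j iff j ≡ i ± 1 (mod n).
-- (Only used for n ≥ 3, where this is the usual simple cycle.)
CycleAdj : (n : ℕ) → Fin n → Fin n → Set
CycleAdj n i j = CycleSucc n i j ⊎ CycleSucc n j i

ProperColouring : (n : ℕ) → (k : ℕ) → (Fin n → Fin k) → Set
ProperColouring n k c = ∀ i j → CycleAdj n i j → ¬ (c i ≡ c j)

Orthogonal : {n k : ℕ} → (Fin n → Fin k) → (Fin n → Fin k) → Set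
Orthogonal c₁ c₂ = Injective _≡_ _≡_ (λ v → (c₁ v , c₂ v))

HasOrthColouring : (n : ℕ) → (k : ℕ) → Set
HasOrthColouring n k =
  Σ (Fin n → Fin k) λ c₁ → Σ (Fin n → Fin k) λ c₂ →
    ProperColouring n k c₁ × ProperColouring n k c₂ × Orthogonal c₁ c₂

IsOrthChromaticNumber : (n : ℕ) → ℕ → Set
IsOrthChromaticNumber n k = HasOrthColouring n k × (∀ j → HasOrthColouring n j → k ≤ j)

IsCeilSqrt : ℕ → ℕ → Set
IsCeilSqrt n m = n ≤ m * m × (∀ j → n ≤ j * j → m ≤ j)

-- An orthogonal colouring of C_n with m colours is a cycle of length n in the direct
-- product K_m × K_m: the vertices are the colour pairs, adjacent when both coordinates
-- differ. Hence n ≤ m², and C_3, C_4 need three colours since two colours repeat every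
-- second vertex. Conversely, for m ≥ 3 there are such cycles of every length 2 ≤ n ≤ m².
-- Listing the pairs row by row as (r, r + q mod m) gives a Hamiltonian cycle from which
-- up to m − 2 vertices after the first can be skipped, covering m² − m + 2 ≤ n. For
-- n ≤ (m − 1) m + 1, the pairs (v mod (m − 1), v mod m) are distinct by the Chinese
-- remainder theorem, and one vertex of the spare first colour m − 1 closes the cycle.
module Submission where

open import Defs
open import Data.Nat using (ℕ; suc; _≤_; _<_)
open import Function.Bundles using (_⇔_)
open import Relation.Binary.PropositionalEquality using (_≡_)

open import Data.Nat using (zero; _+_; _*_; _∸_; pred; z≤n; s≤s; z<s; NonZero; _≤?_; _<?_; _≟_)
open import Data.Nat.Properties
open import Data.Nat.DivMod
open import Data.Nat.Divisibility using (_∣_; divides; >⇒∤; *-monoˡ-∣)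
open import Data.Nat.Coprimality using (Coprime; coprime-divisor; coprime-+; 1-coprimeTo)
  renaming (sym to coprime-sym)
open import Data.Fin using (Fin; toℕ; fromℕ<; combine; zero; suc)
open import Data.Fin.Properties using (toℕ-fromℕ<; toℕ<n; toℕ-injective; combine-injective; injective⇒≤)
open import Data.Product using (_×_; _,_; proj₁; proj₂; ∃-syntax)
open import Data.Sum using (inj₁; inj₂)
open import Function using (_∘_)
open import Function.Bundles using (mk⇔)
open import Relation.Nullary using (¬_; Dec; yes; no; contradiction)
open import Relation.Binary.PropositionalEquality
  using (_≢_; refl; sym; trans; cong; cong₂; subst; subst₂; ≢-sym; module ≡-Reasoning)

∣∧<⇒≡0 : ∀ {d e} → d ∣ e → e < d → e ≡ 0
∣∧<⇒≡0 {e = zero}  _   _   = refl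
∣∧<⇒≡0 {e = suc _} d∣e e<d = contradiction d∣e (>⇒∤ e<d)

%≡%⇒∣∸ : ∀ d .{{_ : NonZero d}} a b → a % d ≡ b % d → d ∣ a ∸ b
%≡%⇒∣∸ d a b eq = divides (a / d ∸ b / d) (begin
  a ∸ b                                     ≡⟨ cong₂ _∸_ (m≡m%n+[m/n]*n a d) (m≡m%n+[m/n]*n b d) ⟩
  (a % d + a / d * d) ∸ (b % d + b / d * d) ≡⟨ cong (λ r → (a % d + a / d * d) ∸ (r + b / d * d)) (sym eq) ⟩
  (a % d + a / d * d) ∸ (a % d + b / d * d) ≡⟨ [m+n]∸[m+o]≡n∸o (a % d) (a / d * d) (b / d * d) ⟩
  a / d * d ∸ b / d * d                     ≡⟨ *-distribʳ-∸ d (a / d) (b / d) ⟨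
  (a / d ∸ b / d) * d                       ∎)
  where open ≡-Reasoning

[k+x]%d≢x%d : ∀ d .{{_ : NonZero d}} {k} x → 0 < k → k < d → (k + x) % d ≢ x % d
[k+x]%d≢x%d d {k} x 0<k k<d eq =
  <⇒≢ 0<k (sym (∣∧<⇒≡0 (subst (d ∣_) (m+n∸n≡m k x) (%≡%⇒∣∸ d (k + x) x eq)) k<d))

%-suc-≢ : ∀ d .{{_ : NonZero d}} v → 1 < d → v % d ≢ suc v % d
%-suc-≢ d v 1<d = ≢-sym ([k+x]%d≢x%d d v z<s 1<d)

[x+a]%d≡[x+b]%d⇒a≡b : ∀ d .{{_ : NonZero d}} x {a b} → a < d → b < d →
                      (x + a) % d ≡ (x + b) % d → a ≡ b
[x+a]%d≡[x+b]%d⇒a≡b d x a<d b<d eq = ≤-antisym (≤-from a<d eq) (≤-from b<d (sym eq))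
  where
  ≤-from : ∀ {a b} → a < d → (x + a) % d ≡ (x + b) % d → a ≤ b
  ≤-from {a} {b} a<d eq = m∸n≡0⇒m≤n (∣∧<⇒≡0
    (subst (d ∣_) ([m+n]∸[m+o]≡n∸o x a b) (%≡%⇒∣∸ d (x + a) (x + b) eq))
    (≤-<-trans (m∸n≤m a b) a<d))

coprime⇒*∣ : ∀ {p m e} → Coprime p m → p ∣ e → m ∣ e → p * m ∣ e
coprime⇒*∣ {p} {m} cop p∣e (divides q refl) =
  *-monoˡ-∣ m (coprime-divisor cop (subst (p ∣_) (*-comm q m) p∣e))

coprime⇒[%,%]-injective : ∀ {p m} .{{_ : NonZero p}} .{{_ : NonZero m}} → Coprime p m →
                          ∀ {v w} → v < p * m → w < p * m →
                          v % p ≡ w % p → v % m ≡ w % m → v ≡ w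
coprime⇒[%,%]-injective {p} {m} cop v< w< eq₁ eq₂ =
  ≤-antisym (≤-from v< eq₁ eq₂) (≤-from w< (sym eq₁) (sym eq₂))
  where
  ≤-from : ∀ {v w} → v < p * m → v % p ≡ w % p → v % m ≡ w % m → v ≤ w
  ≤-from {v} {w} v< eq₁ eq₂ = m∸n≡0⇒m≤n (∣∧<⇒≡0
    (coprime⇒*∣ cop (%≡%⇒∣∸ p v w eq₁) (%≡%⇒∣∸ m v w eq₂))
    (≤-<-trans (m∸n≤m v w) v<))

coprime-suc : ∀ p → Coprime p (suc p)
coprime-suc p = coprime-sym (subst (λ x → Coprime x p) (+-comm p 1) (coprime-+ (1-coprimeTo p)))

m*m<n*n⇒m<n : ∀ {m n} → m * m < n * n → m < n
m*m<n*n⇒m<n m*m<n*n = ≰⇒> (λ n≤m → <⇒≱ m*m<n*n (*-mono-≤ n≤m n≤m))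

∃-nonzero<3-≢ : ∀ c → ∃[ y ] y < 3 × y ≢ 0 × y ≢ c
∃-nonzero<3-≢ c with c ≟ 1
... | yes refl = 2 , ≤-refl , (λ ()) , (λ ())
... | no c≢1   = 1 , s≤s (s≤s z≤n) , (λ ()) , ≢-sym c≢1

Apart : ℕ × ℕ → ℕ × ℕ → Set
Apart x y = proj₁ x ≢ proj₁ y × proj₂ x ≢ proj₂ y

record ProductCycle (n m : ℕ) : Set where
  field
    point     : ℕ → ℕ × ℕ
    bounded   : ∀ v → proj₁ (point v) < m × proj₂ (point v) < m
    apart-suc : ∀ v → suc v < n → Apart (point v) (point (suc v))
    closed    : Apart (point (pred n)) (point 0)
    injective : ∀ v w → v < n → w < n → point v ≡ point w → v ≡ w

cycleSucc-≢ : ∀ {n} (f : ℕ → ℕ) → (∀ v → suc v < n → f v ≢ f (suc v)) → f (pred n) ≢ f 0 →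
              ∀ i j → CycleSucc n i j → f (toℕ i) ≢ f (toℕ j)
cycleSucc-≢ {n} f step wrap i j (inj₁ j≡1+i) =
  subst (λ x → f (toℕ i) ≢ f x) (sym j≡1+i) (step (toℕ i) (subst (_< n) j≡1+i (toℕ<n j)))
cycleSucc-≢ f step wrap i j (inj₂ (1+i≡n , j≡0)) =
  subst₂ (λ x y → f x ≢ f y) (sym (cong pred 1+i≡n)) (sym j≡0) wrap

cycleAdj-≢ : ∀ {n} (f : ℕ → ℕ) → (∀ v → suc v < n → f v ≢ f (suc v)) → f (pred n) ≢ f 0 →
             ∀ i j → CycleAdj n i j → f (toℕ i) ≢ f (toℕ j)
cycleAdj-≢ f step wrap i j (inj₁ succ) = cycleSucc-≢ f step wrap i j succ
cycleAdj-≢ f step wrap i j (inj₂ succ) = ≢-sym (cycleSucc-≢ f step wrap j i succ)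

ProductCycle⇒HasOrthColouring : ∀ {n m} → ProductCycle n m → HasOrthColouring n m
ProductCycle⇒HasOrthColouring {n} {m} C =
  colouring proj₁ (proj₁ ∘ bounded) , colouring proj₂ (proj₂ ∘ bounded) ,
  proper proj₁ (proj₁ ∘ bounded) (λ v v< → proj₁ (apart-suc v v<)) (proj₁ closed) ,
  proper proj₂ (proj₂ ∘ bounded) (λ v v< → proj₂ (apart-suc v v<)) (proj₂ closed) ,
  orthogonal
  where
  open ProductCycle C

  colouring : (π : ℕ × ℕ → ℕ) → (∀ v → π (point v) < m) → Fin n → Fin m
  colouring π π< i = fromℕ< (π< (toℕ i))

  colouring-≡ : ∀ π π< {i j} → colouring π π< i ≡ colouring π π< j →
                π (point (toℕ i)) ≡ π (point (toℕ j))
  colouring-≡ π π< eq = trans (sym (toℕ-fromℕ< _)) (trans (cong toℕ eq) (toℕ-fromℕ< _))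

  proper : ∀ π π< → (∀ v → suc v < n → π (point v) ≢ π (point (suc v))) →
           π (point (pred n)) ≢ π (point 0) → ProperColouring n m (colouring π π<)
  proper π π< step wrap i j adj = cycleAdj-≢ (π ∘ point) step wrap i j adj ∘ colouring-≡ π π<

  orthogonal : Orthogonal (colouring proj₁ (proj₁ ∘ bounded)) (colouring proj₂ (proj₂ ∘ bounded))
  orthogonal {i} {j} eq = toℕ-injective (injective (toℕ i) (toℕ j) (toℕ<n i) (toℕ<n j)
    (cong₂ _,_ (colouring-≡ proj₁ (proj₁ ∘ bounded) (cong proj₁ eq))
               (colouring-≡ proj₂ (proj₂ ∘ bounded) (cong proj₂ eq))))

module Rows (m : ℕ) .{{_ : NonZero m}} where

  row : ℕ → ℕ × ℕ
  row v = v % m , (v % m + v / m) % m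

  row-bounded : ∀ v → proj₁ (row v) < m × proj₂ (row v) < m
  row-bounded v = m%n<n v m , m%n<n (v % m + v / m) m

  row-digits : ∀ {r} q → r < m → row (r + q * m) ≡ (r , (r + q) % m)
  row-digits {r} q r<m = cong₂ _,_ remainder (cong₂ (λ a b → (a + b) % m) remainder quotient)
    where
    remainder : (r + q * m) % m ≡ r
    remainder = trans ([m+kn]%n≡m%n r q m) (m<n⇒m%n≡m r<m)
    quotient : (r + q * m) / m ≡ q
    quotient = trans (+-distrib-/-∣ʳ r (divides q refl)) (cong₂ _+_ (m<n⇒m/n≡0 r<m) (m*n/n≡m q m))

  row-small : ∀ {r} → r < m → row r ≡ (r , r)
  row-small {r} r<m = begin
    row r              ≡⟨ cong row (+-identityʳ r) ⟨
    row (r + 0 * m)    ≡⟨ row-digits 0 r<m ⟩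
    (r , (r + 0) % m)  ≡⟨ cong (λ x → r , x % m) (+-identityʳ r) ⟩
    (r , r % m)        ≡⟨ cong (r ,_) (m<n⇒m%n≡m r<m) ⟩
    (r , r)            ∎
    where open ≡-Reasoning

  row-apart-inner : ∀ {r} q → suc r < m → Apart (row (r + q * m)) (row (suc r + q * m))
  row-apart-inner {r} q 1+r<m =
    subst₂ Apart (sym (row-digits q (<-trans (n<1+n r) 1+r<m))) (sym (row-digits q 1+r<m))
      (<⇒≢ (n<1+n r) , %-suc-≢ m (r + q) (≤-trans (s≤s (s≤s z≤n)) 1+r<m))

  -- At the end of a row the second coordinate drops by m − 2, which is nonzero mod m as m ≥ 3.
  row-apart-wrap : ∀ {r} q → 2 ≤ r → suc r ≡ m → Apart (row (r + q * m)) (row (suc r + q * m))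
  row-apart-wrap {suc r′} q (s≤s 1≤r′) 1+r≡m =
    subst₂ Apart (sym (row-digits q r<m)) (sym next-row)
      ((λ ()) , λ eq → [k+x]%d≢x%d m (suc q) 1≤r′ (<-trans (n<1+n r′) r<m)
                        (trans (cong (_% m) (+-suc r′ q)) eq))
    where
    r<m : suc r′ < m
    r<m = subst (suc r′ <_) 1+r≡m (n<1+n (suc r′))
    next-row : row (suc (suc r′) + q * m) ≡ (0 , suc q % m)
    next-row = trans (cong (λ x → row (x + q * m)) 1+r≡m)
                     (row-digits (suc q) (subst (0 <_) 1+r≡m z<s))

  row-apart-suc : 3 ≤ m → ∀ v → Apart (row v) (row (suc v))
  row-apart-suc 3≤m v = subst (λ u → Apart (row u) (row (suc u))) (sym (m≡m%n+[m/n]*n v m))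
                          (by-digit (suc (v % m) <? m))
    where
    by-digit : Dec (suc (v % m) < m) →
               Apart (row (v % m + v / m * m)) (row (suc (v % m) + v / m * m))
    by-digit (yes 1+r<m) = row-apart-inner (v / m) 1+r<m
    by-digit (no 1+r≮m)  = row-apart-wrap (v / m) (≤-pred (subst (3 ≤_) (sym 1+r≡m) 3≤m)) 1+r≡m
      where
      1+r≡m : suc (v % m) ≡ m
      1+r≡m = ≤-antisym (m%n<n v m) (≮⇒≥ 1+r≮m)

  row-injective : ∀ {v w} → v < m * m → w < m * m → row v ≡ row w → v ≡ w
  row-injective {v} {w} v< w< eq = begin
    v                  ≡⟨ m≡m%n+[m/n]*n v m ⟩
    v % m + v / m * m  ≡⟨ cong₂ (λ r q → r + q * m) same-r same-q ⟩
    w % m + w / m * m  ≡⟨ m≡m%n+[m/n]*n w m ⟨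
    w                  ∎
    where
    open ≡-Reasoning
    same-r : v % m ≡ w % m
    same-r = cong proj₁ eq
    same-q : v / m ≡ w / m
    same-q = [x+a]%d≡[x+b]%d⇒a≡b m (w % m) (m<n*o⇒m/o<n v<) (m<n*o⇒m/o<n w<)
               (trans (cong (λ r → (r + v / m) % m) (sym same-r)) (cong proj₂ eq))

longCycle : ∀ {m d n} → 3 ≤ m → suc d < m → 2 ≤ n → n + d ≡ m * m → ProductCycle n m
longCycle {m@(suc (suc (suc t)))} {d} {suc (suc k)}
          3≤m@(s≤s (s≤s (s≤s _))) 1+d<m (s≤s (s≤s _)) n+d≡m*m = record
  { point     = row ∘ index
  ; bounded   = row-bounded ∘ index
  ; apart-suc = apart-suc
  ; closed    = subst (λ u → Apart (row u) (0 , 0)) (sym (suc-injective n+d≡m*m)) last-apart-first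
  ; injective = λ v w v<n w<n eq → index-injective v w (row-injective (index-< v v<n) (index-< w w<n) eq)
  }
  where
  open Rows m

  index : ℕ → ℕ
  index zero    = zero
  index (suc v) = suc v + d

  apart-suc : ∀ v → suc v < suc (suc k) → Apart (row (index v)) (row (index (suc v)))
  apart-suc zero    _ = subst (Apart (0 , 0)) (sym (row-small 1+d<m)) ((λ ()) , (λ ()))
  apart-suc (suc v) _ = row-apart-suc 3≤m (suc v + d)

  -- The last vertex is (m − 1, m − 2).
  last-apart-first : Apart (row (suc (suc t) + suc (suc t) * m)) (0 , 0)
  last-apart-first = subst (λ x → Apart x (0 , 0)) (sym (row-digits (suc (suc t)) ≤-refl))
    ((λ ()) , λ eq → contradiction (trans (sym m-2) eq) λ ())
    where
    m-2 : (suc (suc t) + suc (suc t)) % m ≡ suc t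
    m-2 = begin
      (suc (suc t) + suc (suc t)) % m ≡⟨ cong (λ x → suc x % m) (+-suc t (suc (suc t))) ⟨
      (suc t + m) % m                 ≡⟨ [m+n]%n≡m%n (suc t) m ⟩
      suc t % m                       ≡⟨ m<n⇒m%n≡m (n≤1+n (suc (suc t))) ⟩
      suc t                           ∎
      where open ≡-Reasoning

  index-< : ∀ v → v < suc (suc k) → index v < m * m
  index-< zero    _   = z<s
  index-< (suc v) v<n = subst (suc v + d <_) n+d≡m*m (+-monoˡ-< d v<n)

  index-injective : ∀ v w → index v ≡ index w → v ≡ w
  index-injective zero    zero    _  = refl
  index-injective (suc v) (suc w) eq = +-cancelʳ-≡ d (suc v) (suc w) eq

shortCycle : ∀ {p m n} → 2 ≤ p → p < m → Coprime p m → 2 ≤ n → n ≤ suc (p * m) → ProductCycle n m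
shortCycle {p@(suc _)} {m@(suc _)} {suc (suc k)} 2≤p p<m cop (s≤s (s≤s _)) n≤
  with ∃-nonzero<3-≢ (k % m)
... | y , y<3 , y≢0 , y≢k%m = record
  { point     = point
  ; bounded   = bounded
  ; apart-suc = apart-suc
  ; closed    = <⇒≢ (m%n<n k p) , ≢-sym y≢k%m
  ; injective = injective
  }
  where
  point : ℕ → ℕ × ℕ
  point zero    = p , y
  point (suc v) = v % p , v % m

  bounded : ∀ v → proj₁ (point v) < m × proj₂ (point v) < m
  bounded zero    = p<m , <-≤-trans y<3 (≤-trans (s≤s 2≤p) p<m)
  bounded (suc v) = <-trans (m%n<n v p) p<m , m%n<n v m

  apart-suc : ∀ v → suc v < suc (suc k) → Apart (point v) (point (suc v))
  apart-suc zero    _ = (λ ()) , y≢0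
  apart-suc (suc v) _ = %-suc-≢ p v 2≤p , %-suc-≢ m v (≤-trans 2≤p (<⇒≤ p<m))

  below : ∀ {v} → suc v < suc (suc k) → v < p * m
  below v<n = ≤-pred (≤-trans v<n n≤)

  injective : ∀ v w → v < suc (suc k) → w < suc (suc k) → point v ≡ point w → v ≡ w
  injective zero    zero    _   _   _  = refl
  injective zero    (suc w) _   _   eq = contradiction (cong proj₁ eq) (>⇒≢ (m%n<n w p))
  injective (suc v) zero    _   _   eq = contradiction (cong proj₁ eq) (<⇒≢ (m%n<n v p))
  injective (suc v) (suc w) v<n w<n eq =
    cong suc (coprime⇒[%,%]-injective cop (below v<n) (below w<n) (cong proj₁ eq) (cong proj₂ eq))

n≤m*m⇒HasOrthColouring : ∀ {m n} → 3 ≤ m → 2 ≤ n → n ≤ m * m → HasOrthColouring n m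
n≤m*m⇒HasOrthColouring {suc p} {n} (s≤s 2≤p) 2≤n n≤m*m with n ≤? suc (p * suc p)
... | yes n≤ = ProductCycle⇒HasOrthColouring (shortCycle 2≤p ≤-refl (coprime-suc p) 2≤n n≤)
... | no n≰  = ProductCycle⇒HasOrthColouring
                 (longCycle (s≤s 2≤p) 1+d<m 2≤n (m+[n∸m]≡n n≤m*m))
  where
  m d : ℕ
  m = suc p
  d = m * m ∸ n
  1+d<m : suc d < m
  1+d<m = +-cancelʳ-≤ (p * m) (suc (suc d)) m (begin
    suc (suc d) + p * m    ≡⟨ cong (2 +_) (+-comm d (p * m)) ⟩
    suc (suc (p * m)) + d  ≤⟨ +-monoˡ-≤ d (≰⇒> n≰) ⟩
    n + d                  ≡⟨ m+[n∸m]≡n n≤m*m ⟩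
    m * m                  ∎)
    where open ≤-Reasoning

HasOrthColouring⇒n≤k*k : ∀ {n k} → HasOrthColouring n k → n ≤ k * k
HasOrthColouring⇒n≤k*k (c₁ , c₂ , _ , _ , orthogonal) =
  injective⇒≤ {f = λ v → combine (c₁ v) (c₂ v)} λ eq →
    let (c₁≡ , c₂≡) = combine-injective _ _ _ _ eq in orthogonal (cong₂ _,_ c₁≡ c₂≡)

Fin2-≢-≢⇒≡ : ∀ {x y z : Fin 2} → x ≢ y → y ≢ z → x ≡ z
Fin2-≢-≢⇒≡ {zero}     {zero}     x≢y _   = contradiction refl x≢y
Fin2-≢-≢⇒≡ {suc zero} {suc zero} x≢y _   = contradiction refl x≢y
Fin2-≢-≢⇒≡ {zero}     {suc zero} {zero}     _ _   = refl
Fin2-≢-≢⇒≡ {suc zero} {zero}     {suc zero} _ _   = refl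
Fin2-≢-≢⇒≡ {zero}     {suc zero} {suc zero} _ y≢z = contradiction refl y≢z
Fin2-≢-≢⇒≡ {suc zero} {zero}     {zero}     _ y≢z = contradiction refl y≢z

proper-2-colouring-0≡2 : ∀ {n} {c : Fin (3 + n) → Fin 2} → ProperColouring (3 + n) 2 c →
                         c zero ≡ c (suc (suc zero))
proper-2-colouring-0≡2 proper =
  Fin2-≢-≢⇒≡ (proper _ _ (inj₁ (inj₁ refl))) (proper _ _ (inj₁ (inj₁ refl)))

¬HasOrthColouring-2 : ∀ {n} → 3 ≤ n → n ≤ 4 → ¬ HasOrthColouring n 2
¬HasOrthColouring-2 {3} _ _ (_ , _ , proper₁ , _) =
  proper₁ (suc (suc zero)) zero (inj₁ (inj₂ (refl , refl))) (sym (proper-2-colouring-0≡2 proper₁))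
¬HasOrthColouring-2 {4} _ _ (_ , _ , proper₁ , proper₂ , orthogonal)
  with orthogonal (cong₂ _,_ (proper-2-colouring-0≡2 proper₁) (proper-2-colouring-0≡2 proper₂))
... | ()
¬HasOrthColouring-2 {1} (s≤s ()) _
¬HasOrthColouring-2 {2} (s≤s (s≤s ())) _
¬HasOrthColouring-2 {suc (suc (suc (suc (suc _))))} _ (s≤s (s≤s (s≤s (s≤s ()))))

theorem3 : (n : ℕ) → 3 ≤ n → (k m : ℕ) →
    IsOrthChromaticNumber n k → IsCeilSqrt n m → (k ≡ m) ⇔ (4 < n)
theorem3 n 3≤n k m (has-k , k-least) (n≤m*m , m-least) = mk⇔ ⇒ ⇐
  where
  ⇐ : 4 < n → k ≡ m
  ⇐ 4<n = ≤-antisym (k-least m has-m) (m-least k (HasOrthColouring⇒n≤k*k has-k))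
    where
    3≤m : 3 ≤ m
    3≤m = m*m<n*n⇒m<n (<-≤-trans 4<n n≤m*m)
    has-m : HasOrthColouring n m
    has-m = n≤m*m⇒HasOrthColouring 3≤m (≤-trans (n≤1+n 2) 3≤n) n≤m*m

  ⇒ : k ≡ m → 4 < n
  ⇒ k≡m with 4 <? n
  ... | yes 4<n = 4<n
  ... | no 4≮n  = contradiction (subst (HasOrthColouring n) (trans k≡m m≡2) has-k)
                                (¬HasOrthColouring-2 3≤n (≮⇒≥ 4≮n))
    where
    m≡2 : m ≡ 2
    m≡2 = ≤-antisym (m-least 2 (≮⇒≥ 4≮n))
                    (m*m<n*n⇒m<n (<-≤-trans (s≤s (s≤s z≤n)) (≤-trans 3≤n n≤m*m)))
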